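{- Let $S\in\Sigma^m$ be a string, $f_S$ its failure function/tree, and $B\subseteq\{0,\dots,m\}$ prefix-incomparable for $S$. Then $|B|\le w$, where $w$ is the number of leaves of $f_S$, equivalently $w=|\{i\in\{0,\dots,m\}:\text{there is no } j \text{ with } f_S(j)=i\}|$.
   Context: A border of a string is a segment that is simultaneously a proper prefix and a proper suffix of it (the empty string counts). The failure function $f_S:\{1,\dots,m\}\to\{0,\dots,m\}$ maps $i$ to the length of the longest border of $S[1..i]$; the failure tree is the in-tree on $\{0,\dots,m\}$ with edges $(i,f_S(i))$. Indices $i<j$ are prefix-incomparable for $S$ if $S[1..i]$ is not a border of $S[1..j]$; a set $B$ is prefix-incomparable if every pair $i<j$ in $B$ is. -}

module Defs where

open import Data.Nat using (ℕ; zero; suc; _∸_; _<_; _≤_; _≟_; _<?_)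
open import Data.List using (List; []; _∷_; take; drop; length; filter; map; upTo)
open import Data.List.Properties using (≡-dec)
open import Data.List.Relation.Unary.Any using (any?)
open import Data.Product using (_×_)
open import Relation.Binary.PropositionalEquality using (_≡_)
open import Relation.Binary.Definitions using (DecidableEquality)
open import Relation.Nullary using (¬_; Dec; yes; no; ¬?)
open import Relation.Nullary.Decidable using (_×-dec_)

module _ {A : Set} (_≟A_ : DecidableEquality A) (S : List A) where

  -- Strings are 1-indexed in the paper; S[1..j] = take j S.
  -- S[1..i] is a (proper) border of S[1..j]:
  --   i < j and the length-i prefix of S[1..j] equals its length-i suffix.
  IsBorder : ℕ → ℕ → Set
  IsBorder i j = (i < j) × (take i (take j S) ≡ drop (j ∸ i) (take j S))

  isBorder? : (i j : ℕ) → Dec (IsBorder i j)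
  isBorder? i j = (i <? j) ×-dec ≡-dec _≟A_ (take i (take j S)) (drop (j ∸ i) (take j S))

  PrefixIncomparable : ℕ → ℕ → Set
  PrefixIncomparable i j = ¬ IsBorder i j

  longestBelow : ℕ → ℕ → ℕ
  longestBelow j zero = 0
  longestBelow j (suc n) with isBorder? n j
  ... | yes _ = n
  ... | no  _ = longestBelow j n

  -- failure function f_S(j) = length of the longest border of S[1..j]  (1 ≤ j ≤ m)
  failure : ℕ → ℕ
  failure j = longestBelow j j

  IsLeaf : ℕ → Set
  IsLeaf i = ¬ Data.List.Relation.Unary.Any.Any (λ j → failure j ≡ i) (map suc (upTo (length S)))

  isLeaf? : (i : ℕ) → Dec (IsLeaf i)
  isLeaf? i = ¬? (any? (λ j → failure j ≟ i) (map suc (upTo (length S))))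

  numLeaves : ℕ
  numLeaves = length (filter isLeaf? (upTo (suc (length S))))

{-# OPTIONS --safe #-}
-- Every node of the failure tree has a leaf among its descendants, and every node is a
-- border of each of its proper descendants. Map each element of B to such a leaf: if two
-- elements i < i' were sent to the same leaf L, both would be borders of S[1..L], and of
-- two borders of one string the shorter is a border of the longer, so i, i' would be
-- prefix-comparable. The map is therefore injective, and |B| is at most the number of leaves.
module Submission where

open import Defs
open import Data.Nat using (ℕ; zero; suc; _+_; _∸_; _⊓_; _≤_; _<_; _≟_; z≤n; s≤s)
open import Data.Nat.Properties
open import Data.Nat.Induction using (<-wellFounded)
open import Data.List using (List; []; _∷_; length; map; take; drop; upTo; filter)
open import Data.List.Properties using (length-map; length-take; take-take; drop-drop; drop-all; length-removeAt′)
open import Data.List.Membership.Propositional using (_∈_; find)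
open import Data.List.Membership.Propositional.Properties using (∈-map⁻; ∈-filter⁺; ∈-upTo⁺; ∈-upTo⁻)
open import Data.List.Relation.Binary.Subset.Propositional using (_⊆_)
open import Data.List.Relation.Unary.All as All using (All)
open import Data.List.Relation.Unary.All.Properties as All using ()
open import Data.List.Relation.Unary.Any using (Any; here; there; any?; _─_)
open import Data.List.Relation.Unary.Any.Properties as Any using ()
open import Data.List.Relation.Unary.AllPairs using ([]; _∷_)
open import Data.List.Relation.Unary.Unique.Propositional using (Unique)
open import Data.Product using (Σ-syntax; ∃-syntax; _×_; _,_; proj₁; proj₂)
open import Data.Sum using (_⊎_; inj₁; inj₂)
open import Function using (_on_)
open import Induction.WellFounded using (Acc; acc)
open import Relation.Binary.Construct.On as On using ()
open import Relation.Binary.Definitions using (DecidableEquality; tri<; tri≈; tri>)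
open import Relation.Binary.PropositionalEquality using (_≡_; _≢_; refl; sym; cong; subst; module ≡-Reasoning)
open import Relation.Nullary using (Dec; yes; no; contradiction)

module _ {X : Set} where

  ∈-─⁺ : ∀ {x y : X} {ys} (x∈ys : x ∈ ys) → y ∈ ys → x ≢ y → y ∈ (ys ─ x∈ys)
  ∈-─⁺ (here refl) (here refl) x≢y = contradiction refl x≢y
  ∈-─⁺ (here refl) (there y∈ys) _   = y∈ys
  ∈-─⁺ (there x∈ys) (here refl) _   = here refl
  ∈-─⁺ (there x∈ys) (there y∈ys) x≢y = there (∈-─⁺ x∈ys y∈ys x≢y)

  Unique-⊆⇒length-≤ : ∀ {xs ys : List X} → Unique xs → xs ⊆ ys → length xs ≤ length ys
  Unique-⊆⇒length-≤ {[]}     _           _      = z≤n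
  Unique-⊆⇒length-≤ {x ∷ xs} {ys} (x∉xs ∷ xs!) xs⊆ys = begin
    suc (length xs)          ≤⟨ s≤s (Unique-⊆⇒length-≤ xs! xs⊆ys─x) ⟩
    suc (length (ys ─ x∈ys)) ≡⟨ sym (length-removeAt′ ys _) ⟩
    length ys                ∎
    where
    open ≤-Reasoning
    x∈ys = xs⊆ys (here refl)
    xs⊆ys─x : xs ⊆ (ys ─ x∈ys)
    xs⊆ys─x y∈xs = ∈-─⁺ x∈ys (xs⊆ys (there y∈xs)) (All.lookup x∉xs y∈xs)

  map⁺-injectiveOn : ∀ {Y : Set} (f : X → Y) {xs} → Unique xs →
                     (∀ {x y} → x ∈ xs → y ∈ xs → f x ≡ f y → x ≡ y) → Unique (map f xs)
  map⁺-injectiveOn f []           _   = []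
  map⁺-injectiveOn f (x∉xs ∷ xs!) inj =
    All.map⁺ (All.tabulate λ y∈xs fx≡fy → All.lookup x∉xs y∈xs (inj (here refl) (there y∈xs) fx≡fy))
    ∷ map⁺-injectiveOn f xs! (λ x∈ y∈ → inj (there x∈) (there y∈))

[m∸n]+[n∸o]≡m∸o : ∀ {m n o} → o ≤ n → n ≤ m → (m ∸ n) + (n ∸ o) ≡ m ∸ o
[m∸n]+[n∸o]≡m∸o {m} {n} {o} o≤n n≤m = begin
  (m ∸ n) + (n ∸ o)  ≡⟨ sym (+-∸-assoc (m ∸ n) o≤n) ⟩
  (m ∸ n) + n ∸ o    ≡⟨ cong (_∸ o) (m∸n+n≡m n≤m) ⟩
  m ∸ o              ∎
  where open ≡-Reasoning

take-take-≤ : ∀ {X : Set} {a c} (xs : List X) → a ≤ c → take a (take c xs) ≡ take a xs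
take-take-≤ {a = a} {c} xs a≤c = begin
  take a (take c xs)  ≡⟨ take-take a c xs ⟩
  take (a ⊓ c) xs     ≡⟨ cong (λ k → take k xs) (m≤n⇒m⊓n≡m a≤c) ⟩
  take a xs           ∎
  where open ≡-Reasoning

module Borders {A : Set} (_≟A_ : DecidableEquality A) (S : List A) where

  m : ℕ
  m = length S

  infix 4 _⊏_ _⊑_

  _⊏_ : ℕ → ℕ → Set
  i ⊏ j = IsBorder _≟A_ S i j

  _⊑_ : ℕ → ℕ → Set
  i ⊑ j = i ≡ j ⊎ i ⊏ j

  0⊏ : ∀ {j} → 0 < j → 0 ⊏ j
  0⊏ {j} 0<j = 0<j , sym (drop-all j (take j S) (≤-trans (≤-reflexive (length-take j S)) (m⊓n≤m j m)))

  longestBelow-⊏ : ∀ {j} → 0 ⊏ j → ∀ n → longestBelow _≟A_ S j n ⊏ j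
  longestBelow-⊏ 0⊏j zero = 0⊏j
  longestBelow-⊏ {j} 0⊏j (suc n) with isBorder? _≟A_ S n j
  ... | yes n⊏j = n⊏j
  ... | no  _   = longestBelow-⊏ 0⊏j n

  failure-⊏ : ∀ {j} → 0 < j → failure _≟A_ S j ⊏ j
  failure-⊏ {j} 0<j = longestBelow-⊏ (0⊏ 0<j) j

  ⊏-trans : ∀ {b j L} → b ⊏ j → j ⊏ L → b ⊏ L
  ⊏-trans {b} {j} {L} (b<j , b-border) (j<L , j-border) = <-trans b<j j<L , (begin
    take b x                        ≡⟨ sym (take-take-≤ x b≤j) ⟩
    take b (take j x)               ≡⟨ cong (take b) Sⱼ ⟩
    take b (take j S)               ≡⟨ b-border ⟩
    drop (j ∸ b) (take j S)         ≡⟨ cong (drop (j ∸ b)) (sym Sⱼ) ⟩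
    drop (j ∸ b) (take j x)         ≡⟨ cong (drop (j ∸ b)) j-border ⟩
    drop (j ∸ b) (drop (L ∸ j) x)   ≡⟨ drop-drop (L ∸ j) (j ∸ b) x ⟩
    drop ((L ∸ j) + (j ∸ b)) x      ≡⟨ cong (λ k → drop k x) ([m∸n]+[n∸o]≡m∸o b≤j (<⇒≤ j<L)) ⟩
    drop (L ∸ b) x                  ∎)
    where
    open ≡-Reasoning
    x = take L S
    b≤j = <⇒≤ b<j
    Sⱼ : take j x ≡ take j S
    Sⱼ = take-take-≤ S (<⇒≤ j<L)

  ⊏-nested : ∀ {b b' L} → b ⊏ L → b' ⊏ L → b < b' → b ⊏ b'
  ⊏-nested {b} {b'} {L} (_ , b-border) (b'<L , b'-border) b<b' = b<b' , (begin
    take b (take b' S)              ≡⟨ cong (take b) (sym Sᵦ′) ⟩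
    take b (take b' x)              ≡⟨ take-take-≤ x b≤b' ⟩
    take b x                        ≡⟨ b-border ⟩
    drop (L ∸ b) x                  ≡⟨ cong (λ k → drop k x) (sym ([m∸n]+[n∸o]≡m∸o b≤b' (<⇒≤ b'<L))) ⟩
    drop ((L ∸ b') + (b' ∸ b)) x    ≡⟨ sym (drop-drop (L ∸ b') (b' ∸ b) x) ⟩
    drop (b' ∸ b) (drop (L ∸ b') x) ≡⟨ cong (drop (b' ∸ b)) (sym b'-border) ⟩
    drop (b' ∸ b) (take b' x)       ≡⟨ cong (drop (b' ∸ b)) Sᵦ′ ⟩
    drop (b' ∸ b) (take b' S)       ∎)
    where
    open ≡-Reasoning
    x = take L S
    b≤b' = <⇒≤ b<b'
    Sᵦ′ : take b' x ≡ take b' S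
    Sᵦ′ = take-take-≤ S (<⇒≤ b'<L)

  ⊑-nested : ∀ {b b' L} → b < b' → b ⊑ L → b' ⊑ L → b ⊏ b'
  ⊑-nested b<b' (inj₁ refl) (inj₁ refl)   = contradiction b<b' (<-irrefl refl)
  ⊑-nested b<b' (inj₁ refl) (inj₂ b'⊏b)   = contradiction b<b' (<-asym (proj₁ b'⊏b))
  ⊑-nested b<b' (inj₂ b⊏L)  (inj₁ refl)   = b⊏L
  ⊑-nested b<b' (inj₂ b⊏L)  (inj₂ b'⊏L)   = ⊏-nested b⊏L b'⊏L b<b'

  ⊏-⊑-trans : ∀ {b j L} → b ⊏ j → j ⊑ L → b ⊑ L
  ⊏-⊑-trans b⊏j (inj₁ refl) = inj₂ b⊏j
  ⊏-⊑-trans b⊏j (inj₂ j⊏L)  = inj₂ (⊏-trans b⊏j j⊏L)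

  HasChild : ℕ → Set
  HasChild i = Any (λ j → failure _≟A_ S j ≡ i) (map suc (upTo m))

  hasChild? : ∀ i → Dec (HasChild i)
  hasChild? i = any? (λ j → failure _≟A_ S j ≟ i) (map suc (upTo m))

  child-⊏ : ∀ {i} → HasChild i → ∃[ j ] j ≤ m × i ⊏ j
  child-⊏ child with find (Any.map⁻ child)
  ... | k , k∈upTo , refl = suc k , ∈-upTo⁻ k∈upTo , failure-⊏ (s≤s z≤n)

  LeafBelow : ℕ → Set
  LeafBelow i = Σ[ L ∈ ℕ ] IsLeaf _≟A_ S L × i ⊑ L × (i ≤ m → L ≤ m)

  leafBelow : ∀ i → LeafBelow i
  leafBelow i = go (On.wellFounded (m ∸_) <-wellFounded i)
    where
    go : ∀ {i} → Acc (_<_ on (m ∸_)) i → LeafBelow i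
    go {i} (acc rec) with hasChild? i
    ... | no i-leaf = i , i-leaf , inj₁ refl , (λ i≤m → i≤m)
    ... | yes child with child-⊏ child
    ...   | j , j≤m , i⊏j with go (rec (∸-monoʳ-< (proj₁ i⊏j) j≤m))
    ...     | L , L-leaf , j⊑L , L≤m = L , L-leaf , ⊏-⊑-trans i⊏j j⊑L , (λ _ → L≤m j≤m)

  leaf : ℕ → ℕ
  leaf i = proj₁ (leafBelow i)

  leaf-isLeaf : ∀ i → IsLeaf _≟A_ S (leaf i)
  leaf-isLeaf i = proj₁ (proj₂ (leafBelow i))

  ⊑-leaf : ∀ i → i ⊑ leaf i
  ⊑-leaf i = proj₁ (proj₂ (proj₂ (leafBelow i)))

  leaf-≤ : ∀ {i} → i ≤ m → leaf i ≤ m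
  leaf-≤ {i} = proj₂ (proj₂ (proj₂ (leafBelow i)))

  leaf-distinct : ∀ {i i'} → i < i' → PrefixIncomparable _≟A_ S i i' → leaf i ≢ leaf i'
  leaf-distinct {i} {i'} i<i' incomparable same =
    incomparable (⊑-nested i<i' (⊑-leaf i) (subst (i' ⊑_) (sym same) (⊑-leaf i')))

lemma27 : {A : Set} (_≟A_ : DecidableEquality A) (S : List A) (B : List ℕ)
          → Unique B
          → All (λ i → i ≤ length S) B
          → (∀ {i j} → i ∈ B → j ∈ B → i < j → PrefixIncomparable _≟A_ S i j)
          → length B ≤ numLeaves _≟A_ S
lemma27 _≟A_ S B B! B≤m incomparable = begin
  length B             ≡⟨ sym (length-map leaf B) ⟩
  length (map leaf B)  ≤⟨ Unique-⊆⇒length-≤ (map⁺-injectiveOn leaf B! leaf-injectiveOn) leaves-are-leaves ⟩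
  numLeaves _≟A_ S     ∎
  where
  open ≤-Reasoning
  open Borders _≟A_ S

  leaf-injectiveOn : ∀ {i j} → i ∈ B → j ∈ B → leaf i ≡ leaf j → i ≡ j
  leaf-injectiveOn {i} {j} i∈B j∈B same with <-cmp i j
  ... | tri< i<j _ _ = contradiction same (leaf-distinct i<j (incomparable i∈B j∈B i<j))
  ... | tri≈ _ i≡j _ = i≡j
  ... | tri> _ _ j<i = contradiction (sym same) (leaf-distinct j<i (incomparable j∈B i∈B j<i))

  leaves-are-leaves : map leaf B ⊆ filter (isLeaf? _≟A_ S) (upTo (suc m))
  leaves-are-leaves L∈ with ∈-map⁻ leaf L∈
  ... | i , i∈B , refl = ∈-filter⁺ (isLeaf? _≟A_ S) (∈-upTo⁺ (s≤s (leaf-≤ (All.lookup B≤m i∈B)))) (leaf-isLeaf i)
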